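{- Let $f$ be a polynomial and let $m\ge 1$ be an integer. Then, as polynomials in $x$, $$(x+1)^m f(\mathbf{F}_{\mathbf{x}})-x^m f(\mathbf{F}_{\mathbf{x}}+m)=\sum_{k=0}^{m-1} f(k)\,(x+1)^{m-1-k}x^k.$$
   Context: ${n\brace k}$ denotes the Stirling numbers of the second kind and $\mathcal{F}_n(x)=\sum_{k=0}^n {n\brace k}k!\,x^k$ the Fubini polynomials. Umbral notation: for a polynomial $h(u)=\sum_k c_k u^k$ in an indeterminate $u$, $h(\mathbf{F}_{\mathbf{x}}):=\sum_k c_k\mathcal{F}_k(x)$, i.e. the image of $h$ under the linear map $u^k\mapsto\mathcal{F}_k(x)$; thus $f(\mathbf{F}_{\mathbf{x}}+m)$ means the polynomial $f(u+m)$ expanded in powers of $u$ and then mapped by $u^k\mapsto \mathcal{F}_k(x)$. -}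

module Defs where

open import Algebra.Bundles using (CommutativeRing)
open import Data.Nat as ℕ using (ℕ; zero; suc)

open import Data.List using (List; []; _∷_)

stirling2 : ℕ → ℕ → ℕ
stirling2 zero    zero    = 1
stirling2 zero    (suc k) = 0
stirling2 (suc n) zero    = 0
stirling2 (suc n) (suc k) = suc k ℕ.* stirling2 n (suc k) ℕ.+ stirling2 n k

module Poly {c ℓ} (R : CommutativeRing c ℓ) where
  open CommutativeRing R

  fromℕ : ℕ → Carrier
  fromℕ zero    = 0#
  fromℕ (suc n) = 1# + fromℕ n

  pow : Carrier → ℕ → Carrier
  pow a zero    = 1#
  pow a (suc n) = a * pow a n

  sumTo : ℕ → (ℕ → Carrier) → Carrier
  sumTo zero    g = 0#
  sumTo (suc n) g = sumTo n g + g n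

  fubini : ℕ → Carrier → Carrier
  fubini n x = sumTo (suc n) (λ k → fromℕ (stirling2 n k ℕ.* (k ℕ.!)) * pow x k)

  -- Polynomials in the indeterminate u over R, as coefficient lists
  -- [c₀ , c₁ , c₂ , …]  representing  Σ c_k u^k.
  Pol : Set c
  Pol = List Carrier

  eval : Pol → Carrier → Carrier
  eval []       y = 0#
  eval (a ∷ as) y = a + y * eval as y

  _+ₚ_ : Pol → Pol → Pol
  []       +ₚ q        = q
  (a ∷ p)  +ₚ []       = a ∷ p
  (a ∷ p)  +ₚ (b ∷ q)  = (a + b) ∷ (p +ₚ q)

  scale : Carrier → Pol → Pol
  scale a []       = []
  scale a (b ∷ p)  = (a * b) ∷ scale a p

  mulLin : Carrier → Pol → Pol
  mulLin a p = (0# ∷ p) +ₚ scale a p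

  -- composition  h(u + a), by Horner: (c₀ + u·g(u))(u+a) = c₀ + (u+a)·g(u+a)
  shiftBy : Carrier → Pol → Pol
  shiftBy a []       = []
  shiftBy a (b ∷ p)  = (b ∷ []) +ₚ mulLin a (shiftBy a p)

  -- umbral map  h(F_x) := Σ_k c_k F_k(x)  for h = Σ c_k u^k
  umbralFrom : ℕ → Pol → Carrier → Carrier
  umbralFrom k []       x = 0#
  umbralFrom k (a ∷ p)  x = a * fubini k x + umbralFrom (suc k) p x

  umbral : Pol → Carrier → Carrier
  umbral h x = umbralFrom 0 h x

module Submission where

-- Write polynomials in u in the falling-factorial basis (u)_j = u(u-1)⋯(u-j+1),
-- storing a polynomial as its coefficient sequence v (so g(u) = Σ_j v j · (u)_j).
-- Since u^k = Σ_j S(k,j) (u)_j, the umbral map is the linear functional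
--   L(g) = Σ_j j! x^j · v j,   with  L(u^k) = F_k(x).
-- In this basis multiplication by u + a is  v ↦ (j + a) v_j + v_{j-1},  and the
-- translation g(u) ↦ g(u+1) is  v ↦ v_j + (j+1) v_{j+1}.  A telescoping sum gives the
-- functional equation of the Fubini polynomials
--   x · L(g(u+1)) + g(0) = (x+1) · L(g(u)),
-- and applying it to g = f(u+m) yields the first-order recurrence
--   x · b(m+1) + f(m) = (x+1) · b(m)      for  b(m) = L(f(u+m)) = f(F_x + m),
-- whose unrolling m times is exactly the theorem.

open import Defs
open import Algebra.Bundles using (CommutativeRing)
open import Data.Nat using (ℕ; _≤_; _∸_)
open import Data.Nat as ℕ using (zero; suc; s≤s; _<_; _!; _≤′_; ≤′-reflexive; ≤′-step)
import Data.Nat.Properties as ℕₚ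
open import Data.List using ([]; _∷_; length)
import Relation.Binary.PropositionalEquality as ≡
import Algebra.Properties.Group as GroupProperties
import Algebra.Solver.Ring.NaturalCoefficients.Default as NaturalCoefficients

-- S(k, j) = 0 for j > k: a k-element set has no partition into more than k blocks.
stirling2-vanishes : ∀ k j → k < j → stirling2 k j ≡.≡ 0
stirling2-vanishes zero    (suc j) _ = ≡.refl
stirling2-vanishes (suc k) (suc j) (s≤s k<j)
  rewrite stirling2-vanishes k (suc j) (ℕₚ.m≤n⇒m≤1+n k<j)
        | stirling2-vanishes k j k<j
        | ℕₚ.*-zeroʳ j
        = ≡.refl

module FallingFactorialCalculus {c ℓ} (R : CommutativeRing c ℓ) where
  open CommutativeRing R
  open Poly R
  open NaturalCoefficients commutativeSemiring using (solve; _:=_; _:+_; _:*_; con)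
  open import Relation.Binary.Reasoning.Setoid setoid

  fromℕ-+ : ∀ m n → fromℕ (m ℕ.+ n) ≈ fromℕ m + fromℕ n
  fromℕ-+ zero    n = sym (+-identityˡ _)
  fromℕ-+ (suc m) n = trans (+-cong refl (fromℕ-+ m n)) (sym (+-assoc _ _ _))

  fromℕ-* : ∀ m n → fromℕ (m ℕ.* n) ≈ fromℕ m * fromℕ n
  fromℕ-* zero    n = sym (zeroˡ _)
  fromℕ-* (suc m) n = begin
    fromℕ (n ℕ.+ m ℕ.* n)        ≈⟨ fromℕ-+ n (m ℕ.* n) ⟩
    fromℕ n + fromℕ (m ℕ.* n)    ≈⟨ +-cong refl (fromℕ-* m n) ⟩
    fromℕ n + fromℕ m * fromℕ n  ≈⟨ solve 2 (λ a b → a :+ b :* a := (con 1 :+ b) :* a) refl (fromℕ n) (fromℕ m) ⟩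
    (1# + fromℕ m) * fromℕ n     ∎

  sumTo-cong< : ∀ n {g h : ℕ → Carrier} → (∀ k → k < n → g k ≈ h k) → sumTo n g ≈ sumTo n h
  sumTo-cong< zero    e = refl
  sumTo-cong< (suc n) e = +-cong (sumTo-cong< n (λ k k<n → e k (ℕₚ.m≤n⇒m≤1+n k<n))) (e n ℕₚ.≤-refl)

  sumTo-cong : ∀ n {g h : ℕ → Carrier} → (∀ k → g k ≈ h k) → sumTo n g ≈ sumTo n h
  sumTo-cong n e = sumTo-cong< n (λ k _ → e k)

  sumTo-linear : ∀ n b (g h : ℕ → Carrier) → sumTo n (λ k → b * g k + h k) ≈ b * sumTo n g + sumTo n h
  sumTo-linear zero    b g h = solve 1 (λ b → con 0 := b :* con 0 :+ con 0) refl b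
  sumTo-linear (suc n) b g h = begin
    sumTo n (λ k → b * g k + h k) + (b * g n + h n) ≈⟨ +-cong (sumTo-linear n b g h) refl ⟩
    (b * sumTo n g + sumTo n h) + (b * g n + h n)
      ≈⟨ solve 5 (λ b s t u v → (b :* s :+ t) :+ (b :* u :+ v) := b :* (s :+ u) :+ (t :+ v)) refl
           b (sumTo n g) (sumTo n h) (g n) (h n) ⟩
    b * (sumTo n g + g n) + (sumTo n h + h n) ∎

  sumTo-scale : ∀ n b (g : ℕ → Carrier) → sumTo n (λ k → b * g k) ≈ b * sumTo n g
  sumTo-scale zero    b g = sym (zeroʳ b)
  sumTo-scale (suc n) b g = trans (+-cong (sumTo-scale n b g) refl) (sym (distribˡ b _ _))

  binomialSum : (ℕ → Carrier) → Carrier → Carrier → ℕ → Carrier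
  binomialSum a y z m = sumTo m (λ k → a k * pow y (m ∸ 1 ∸ k) * pow z k)

  binomialSum-suc : ∀ a y z m → binomialSum a y z (suc m) ≈ y * binomialSum a y z m + a m * 1# * pow z m
  binomialSum-suc a y z m =
    +-cong (trans (sumTo-cong< m raise) (sumTo-scale m y _))
           (reflexive (≡.cong (λ e → a m * pow y e * pow z m) (ℕₚ.n∸n≡0 m)))
    where
    raise : ∀ k → k < m → a k * pow y (m ∸ k) * pow z k ≈ y * (a k * pow y (m ∸ 1 ∸ k) * pow z k)
    raise k (s≤s k≤m-1) = begin
      a k * pow y (suc _ ∸ k) * pow z k
        ≈⟨ reflexive (≡.cong (λ e → a k * pow y e * pow z k) (ℕₚ.+-∸-assoc 1 k≤m-1)) ⟩
      a k * (y * pow y (_ ∸ k)) * pow z k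
        ≈⟨ solve 4 (λ A Y P Z → A :* (Y :* P) :* Z := Y :* (A :* P :* Z)) refl (a k) y (pow y (_ ∸ k)) (pow z k) ⟩
      y * (a k * pow y (_ ∸ k) * pow z k) ∎

  unroll : ∀ (a b : ℕ → Carrier) y z → (∀ m → z * b (suc m) + a m ≈ y * b m) →
           ∀ m → pow y m * b 0 ≈ binomialSum a y z m + pow z m * b m
  unroll a b y z rec zero    = solve 1 (λ B → con 1 :* B := con 0 :+ con 1 :* B) refl (b 0)
  unroll a b y z rec (suc m) = begin
    y * pow y m * b 0                    ≈⟨ *-assoc _ _ _ ⟩
    y * (pow y m * b 0)                  ≈⟨ *-cong refl (unroll a b y z rec m) ⟩
    y * (S + pow z m * b m)
      ≈⟨ solve 4 (λ Y S Z B → Y :* (S :+ Z :* B) := Y :* S :+ Z :* (Y :* B)) refl y S (pow z m) (b m) ⟩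
    y * S + pow z m * (y * b m)          ≈⟨ +-cong refl (*-cong refl (sym (rec m))) ⟩
    y * S + pow z m * (z * b (suc m) + a m)
      ≈⟨ solve 6 (λ Y S P Z B A → Y :* S :+ P :* (Z :* B :+ A) := (Y :* S :+ A :* con 1 :* P) :+ Z :* P :* B) refl
           y S (pow z m) z (b (suc m)) (a m) ⟩
    (y * S + a m * 1# * pow z m) + z * pow z m * b (suc m)
      ≈⟨ +-cong (sym (binomialSum-suc a y z m)) refl ⟩
    binomialSum a y z (suc m) + pow z (suc m) * b (suc m) ∎
    where S = binomialSum a y z m

  -- A sequence v represents the polynomial Σ_j v j · (u)_j.
  Seq : Set c
  Seq = ℕ → Carrier

  _≐_ : Seq → Seq → Set ℓ
  v ≐ w = ∀ j → v j ≈ w j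

  zeroSeq : Seq
  zeroSeq _ = 0#

  one : Seq
  one zero    = 1#
  one (suc j) = 0#

  prev : Seq → Seq
  prev v zero    = 0#
  prev v (suc j) = v j

  prev-cong : ∀ {v w} → v ≐ w → prev v ≐ prev w
  prev-cong e zero    = refl
  prev-cong e (suc j) = e j

  prev-linear : ∀ b v w j → prev (λ i → b * v i + w i) j ≈ b * prev v j + prev w j
  prev-linear b v w zero    = solve 1 (λ b → con 0 := b :* con 0 :+ con 0) refl b
  prev-linear b v w (suc j) = refl

  -- Multiplication by u + a, using  u · (u)_j = (u)_(j+1) + j · (u)_j.
  mulU : Carrier → Seq → Seq
  mulU a v j = (fromℕ j + a) * v j + prev v j

  mulU-cong : ∀ {a a' v w} → a ≈ a' → v ≐ w → mulU a v ≐ mulU a' w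
  mulU-cong ea e j = +-cong (*-cong (+-cong refl ea) (e j)) (prev-cong e j)

  mulU-linear : ∀ a b v w → mulU a (λ i → b * v i + w i) ≐ (λ j → b * mulU a v j + mulU a w j)
  mulU-linear a b v w j = begin
    (fromℕ j + a) * (b * v j + w j) + prev (λ i → b * v i + w i) j
      ≈⟨ +-cong refl (prev-linear b v w j) ⟩
    (fromℕ j + a) * (b * v j + w j) + (b * prev v j + prev w j)
      ≈⟨ solve 7 (λ J a b v w p q → (J :+ a) :* (b :* v :+ w) :+ (b :* p :+ q)
                   := b :* ((J :+ a) :* v :+ p) :+ ((J :+ a) :* w :+ q)) refl
              (fromℕ j) a b (v j) (w j) (prev v j) (prev w j) ⟩
    b * mulU a v j + mulU a w j ∎

  mulU-zero : ∀ a → mulU a zeroSeq ≐ zeroSeq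
  mulU-zero a zero    = solve 1 (λ t → t :* con 0 :+ con 0 := con 0) refl (fromℕ 0 + a)
  mulU-zero a (suc j) = solve 1 (λ t → t :* con 0 :+ con 0 := con 0) refl (fromℕ (suc j) + a)

  mulU-+ : ∀ a v w → mulU a (λ i → v i + w i) ≐ (λ j → mulU a v j + mulU a w j)
  mulU-+ a v w j = begin
    mulU a (λ i → v i + w i) j      ≈⟨ mulU-cong refl (λ i → +-cong (sym (*-identityˡ _)) refl) j ⟩
    mulU a (λ i → 1# * v i + w i) j ≈⟨ mulU-linear a 1# v w j ⟩
    1# * mulU a v j + mulU a w j    ≈⟨ +-cong (*-identityˡ _) refl ⟩
    mulU a v j + mulU a w j         ∎

  mulU-scale : ∀ a b v → mulU a (λ i → b * v i) ≐ (λ j → b * mulU a v j)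
  mulU-scale a b v j = begin
    mulU a (λ i → b * v i) j               ≈⟨ mulU-cong refl (λ i → sym (+-identityʳ _)) j ⟩
    mulU a (λ i → b * v i + zeroSeq i) j   ≈⟨ mulU-linear a b v zeroSeq j ⟩
    b * mulU a v j + mulU a zeroSeq j      ≈⟨ trans (+-cong refl (mulU-zero a j)) (+-identityʳ _) ⟩
    b * mulU a v j                         ∎

  -- The product  p(u + a) · v  for a coefficient list p, by Horner's scheme.
  mulPol : Pol → Carrier → Seq → Seq
  mulPol []      a v j = 0#
  mulPol (b ∷ p) a v j = b * v j + mulU a (mulPol p a v) j

  mulPol-cong : ∀ p {a a' v w} → a ≈ a' → v ≐ w → mulPol p a v ≐ mulPol p a' w
  mulPol-cong []      ea e j = refl
  mulPol-cong (b ∷ p) ea e j = +-cong (*-cong refl (e j)) (mulU-cong ea (mulPol-cong p ea e) j)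

  mulPol-+ : ∀ p q a v → mulPol (p +ₚ q) a v ≐ (λ j → mulPol p a v j + mulPol q a v j)
  mulPol-+ []      q        a v j = sym (+-identityˡ _)
  mulPol-+ (b ∷ p) []       a v j = sym (+-identityʳ _)
  mulPol-+ (b ∷ p) (b' ∷ q) a v j = begin
    (b + b') * v j + mulU a (mulPol (p +ₚ q) a v) j
      ≈⟨ +-cong refl (trans (mulU-cong refl (mulPol-+ p q a v) j) (mulU-+ a _ _ j)) ⟩
    (b + b') * v j + (mulU a (mulPol p a v) j + mulU a (mulPol q a v) j)
      ≈⟨ solve 5 (λ b b' v s t → (b :+ b') :* v :+ (s :+ t) := (b :* v :+ s) :+ (b' :* v :+ t)) refl
           b b' (v j) (mulU a (mulPol p a v) j) (mulU a (mulPol q a v) j) ⟩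
    (b * v j + mulU a (mulPol p a v) j) + (b' * v j + mulU a (mulPol q a v) j) ∎

  mulPol-scale : ∀ d p a v → mulPol (scale d p) a v ≐ (λ j → d * mulPol p a v j)
  mulPol-scale d []      a v j = sym (zeroʳ _)
  mulPol-scale d (b ∷ p) a v j = begin
    d * b * v j + mulU a (mulPol (scale d p) a v) j
      ≈⟨ +-cong refl (trans (mulU-cong refl (mulPol-scale d p a v) j) (mulU-scale a d _ j)) ⟩
    d * b * v j + d * mulU a (mulPol p a v) j
      ≈⟨ solve 4 (λ d b v s → d :* b :* v :+ d :* s := d :* (b :* v :+ s)) refl d b (v j) (mulU a (mulPol p a v) j) ⟩
    d * (b * v j + mulU a (mulPol p a v) j) ∎

  mulPol-mulLin : ∀ d p a v → mulPol (mulLin d p) a v ≐ mulU (a + d) (mulPol p a v)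
  mulPol-mulLin d p a v j = begin
    mulPol ((0# ∷ p) +ₚ scale d p) a v j
      ≈⟨ trans (mulPol-+ (0# ∷ p) (scale d p) a v j) (+-cong refl (mulPol-scale d p a v j)) ⟩
    (0# * v j + ((fromℕ j + a) * mulPol p a v j + prev (mulPol p a v) j)) + d * mulPol p a v j
      ≈⟨ solve 6 (λ u J a e q d → (con 0 :* u :+ ((J :+ a) :* e :+ q)) :+ d :* e := (J :+ (a :+ d)) :* e :+ q) refl
           (v j) (fromℕ j) a (mulPol p a v j) (prev (mulPol p a v) j) d ⟩
    mulU (a + d) (mulPol p a v) j ∎

  mulPol-constant : ∀ b a v → mulPol (b ∷ []) a v ≐ (λ j → b * v j)
  mulPol-constant b a v j = trans (+-cong refl (mulU-zero a j)) (+-identityʳ _)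

  mulPol-shiftBy : ∀ d p a v → mulPol (shiftBy d p) a v ≐ mulPol p (a + d) v
  mulPol-shiftBy d []      a v j = refl
  mulPol-shiftBy d (b ∷ p) a v j = begin
    mulPol ((b ∷ []) +ₚ mulLin d (shiftBy d p)) a v j
      ≈⟨ mulPol-+ (b ∷ []) (mulLin d (shiftBy d p)) a v j ⟩
    mulPol (b ∷ []) a v j + mulPol (mulLin d (shiftBy d p)) a v j
      ≈⟨ +-cong (mulPol-constant b a v j) (mulPol-mulLin d (shiftBy d p) a v j) ⟩
    b * v j + mulU (a + d) (mulPol (shiftBy d p) a v) j
      ≈⟨ +-cong refl (mulU-cong refl (mulPol-shiftBy d p a v) j) ⟩
    b * v j + mulU (a + d) (mulPol p (a + d) v) j ∎

  mulPol-mulU : ∀ p a v → mulPol p a (mulU a v) ≐ mulU a (mulPol p a v)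
  mulPol-mulU []      a v j = sym (mulU-zero a j)
  mulPol-mulU (b ∷ p) a v j = begin
    b * mulU a v j + mulU a (mulPol p a (mulU a v)) j
      ≈⟨ +-cong refl (mulU-cong refl (mulPol-mulU p a v) j) ⟩
    b * mulU a v j + mulU a (mulU a (mulPol p a v)) j
      ≈⟨ sym (mulU-linear a b v (mulU a (mulPol p a v)) j) ⟩
    mulU a (mulPol (b ∷ p) a v) j ∎

  -- The constant coefficient is the value at u = 0, since (u)_j vanishes there for j ≥ 1.
  mulPol-one-at-0 : ∀ p a → mulPol p a one 0 ≈ eval p a
  mulPol-one-at-0 []      a = refl
  mulPol-one-at-0 (b ∷ p) a = begin
    b * 1# + ((0# + a) * mulPol p a one 0 + 0#) ≈⟨ +-cong refl (+-cong (*-cong refl (mulPol-one-at-0 p a)) refl) ⟩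
    b * 1# + ((0# + a) * eval p a + 0#)
      ≈⟨ solve 3 (λ b a e → b :* con 1 :+ ((con 0 :+ a) :* e :+ con 0) := b :+ a :* e) refl b a (eval p a) ⟩
    b + a * eval p a ∎

  -- Translation g(u) ↦ g(u + 1), using  (u+1)_j = (u)_j + j · (u)_(j-1).
  translate : Seq → Seq
  translate v j = v j + fromℕ (suc j) * v (suc j)

  translate-linear : ∀ b v w → translate (λ i → b * v i + w i) ≐ (λ j → b * translate v j + translate w j)
  translate-linear b v w j =
    solve 6 (λ b v w M v' w' → (b :* v :+ w) :+ M :* (b :* v' :+ w') := b :* (v :+ M :* v') :+ (w :+ M :* w')) refl
      b (v j) (w j) (fromℕ (suc j)) (v (suc j)) (w (suc j))

  translate-zero : translate zeroSeq ≐ zeroSeq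
  translate-zero j = solve 1 (λ M → con 0 :+ M :* con 0 := con 0) refl (fromℕ (suc j))

  translate-one : translate one ≐ one
  translate-one zero    = solve 1 (λ M → con 1 :+ M :* con 0 := con 1) refl (fromℕ 1)
  translate-one (suc j) = solve 1 (λ M → con 0 :+ M :* con 0 := con 0) refl (fromℕ (suc (suc j)))

  translate-mulU : ∀ a v → translate (mulU a v) ≐ mulU (a + 1#) (translate v)
  translate-mulU a v zero = solve 3 (λ a v₀ v₁ →
      ((con 0 :+ a) :* v₀ :+ con 0) :+ (con 1 :+ con 0) :* ((con 1 :+ con 0 :+ a) :* v₁ :+ v₀)
        := (con 0 :+ (a :+ con 1)) :* (v₀ :+ (con 1 :+ con 0) :* v₁) :+ con 0) refl a (v 0) (v 1)
  translate-mulU a v (suc i) = solve 5 (λ J a v w P →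
      ((J :+ a) :* v :+ P) :+ (con 1 :+ J) :* ((con 1 :+ J :+ a) :* w :+ v)
        := (J :+ (a :+ con 1)) :* (v :+ (con 1 :+ J) :* w) :+ (P :+ J :* v)) refl
      (fromℕ (suc i)) a (v (suc i)) (v (suc (suc i))) (v i)

  translate-mulPol : ∀ p a → translate (mulPol p a one) ≐ mulPol p (a + 1#) one
  translate-mulPol []      a j = translate-zero j
  translate-mulPol (b ∷ p) a j = begin
    translate (λ i → b * one i + mulU a (mulPol p a one) i) j
      ≈⟨ translate-linear b one (mulU a (mulPol p a one)) j ⟩
    b * translate one j + translate (mulU a (mulPol p a one)) j
      ≈⟨ +-cong (*-cong refl (translate-one j)) (translate-mulU a (mulPol p a one) j) ⟩
    b * one j + mulU (a + 1#) (translate (mulPol p a one)) j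
      ≈⟨ +-cong refl (mulU-cong refl (translate-mulPol p a) j) ⟩
    b * one j + mulU (a + 1#) (mulPol p (a + 1#) one) j ∎

  -- A sequence is supported below K if it vanishes from index K on; all sequences
  -- that occur are, so truncated sums of them do not depend on the truncation point.
  SupportedBelow : ℕ → Seq → Set ℓ
  SupportedBelow K v = ∀ j → K ≤ j → v j ≈ 0#

  one-supported : SupportedBelow 1 one
  one-supported (suc j) _ = refl

  mulU-supported : ∀ K a v → SupportedBelow K v → SupportedBelow (suc K) (mulU a v)
  mulU-supported K a v s (suc j) (s≤s K≤j) = begin
    (fromℕ (suc j) + a) * v (suc j) + v j ≈⟨ +-cong (*-cong refl (s (suc j) (ℕₚ.m≤n⇒m≤1+n K≤j))) (s j K≤j) ⟩
    (fromℕ (suc j) + a) * 0# + 0#         ≈⟨ solve 1 (λ t → t :* con 0 :+ con 0 := con 0) refl (fromℕ (suc j) + a) ⟩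
    0#                                    ∎

  mulPol-supported : ∀ p K a v → SupportedBelow K v → SupportedBelow (length p ℕ.+ K) (mulPol p a v)
  mulPol-supported []      K a v s j _  = refl
  mulPol-supported (b ∷ p) K a v s j le = begin
    b * v j + mulU a (mulPol p a v) j
      ≈⟨ +-cong (*-cong refl (s j (ℕₚ.≤-trans (ℕₚ.m≤n+m K (suc (length p))) le)))
                (mulU-supported _ a _ (mulPol-supported p K a v s) j le) ⟩
    b * 0# + 0# ≈⟨ solve 1 (λ t → t :* con 0 :+ con 0 := con 0) refl b ⟩
    0#          ∎

  -- u^k = Σ_j S(k,j) (u)_j: the Stirling recurrence is multiplication by u.
  power : ℕ → Seq
  power k j = fromℕ (stirling2 k j)

  power-zero : power 0 ≐ one
  power-zero zero    = +-identityʳ _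
  power-zero (suc j) = refl

  power-suc : ∀ k → power (suc k) ≐ mulU 0# (power k)
  power-suc k zero    = solve 1 (λ t → con 0 := (con 0 :+ con 0) :* t :+ con 0) refl (power k 0)
  power-suc k (suc j) = begin
    fromℕ (suc j ℕ.* stirling2 k (suc j) ℕ.+ stirling2 k j)
      ≈⟨ fromℕ-+ (suc j ℕ.* stirling2 k (suc j)) (stirling2 k j) ⟩
    fromℕ (suc j ℕ.* stirling2 k (suc j)) + power k j
      ≈⟨ +-cong (fromℕ-* (suc j) (stirling2 k (suc j))) refl ⟩
    fromℕ (suc j) * power k (suc j) + power k j
      ≈⟨ solve 3 (λ J a b → J :* a :+ b := (J :+ con 0) :* a :+ b) refl (fromℕ (suc j)) (power k (suc j)) (power k j) ⟩
    mulU 0# (power k) (suc j) ∎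

  power-supported : ∀ k → SupportedBelow (suc k) (power k)
  power-supported k j k<j rewrite stirling2-vanishes k j k<j = refl

  module Umbral (x : Carrier) where

    weight : ℕ → Carrier
    weight j = fromℕ (j !) * pow x j

    L : ℕ → Seq → Carrier
    L N v = sumTo N (λ j → weight j * v j)

    L-cong : ∀ N {v w} → v ≐ w → L N v ≈ L N w
    L-cong N e = sumTo-cong N (λ j → *-cong refl (e j))

    L-linear : ∀ N b v w → L N (λ j → b * v j + w j) ≈ b * L N v + L N w
    L-linear N b v w = begin
      L N (λ j → b * v j + w j)
        ≈⟨ sumTo-cong N (λ j → solve 4 (λ C b v w → C :* (b :* v :+ w) := b :* (C :* v) :+ C :* w) refl
                                  (weight j) b (v j) (w j)) ⟩
      sumTo N (λ j → b * (weight j * v j) + weight j * w j) ≈⟨ sumTo-linear N b _ _ ⟩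
      b * L N v + L N w ∎

    L-zero : ∀ N → L N zeroSeq ≈ 0#
    L-zero zero    = refl
    L-zero (suc N) = trans (+-cong (L-zero N) (zeroʳ _)) (+-identityʳ _)

    L-stable : ∀ {K N} v → SupportedBelow K v → K ≤′ N → L N v ≈ L K v
    L-stable v s (≤′-reflexive ≡.refl) = refl
    L-stable {K} {suc N} v s (≤′-step K≤′N) = begin
      L N v + weight N * v N ≈⟨ +-cong (L-stable v s K≤′N) (*-cong refl (s N (ℕₚ.≤′⇒≤ K≤′N))) ⟩
      L K v + weight N * 0#  ≈⟨ trans (+-cong refl (zeroʳ _)) (+-identityʳ _) ⟩
      L K v                  ∎

    L-agree : ∀ {K N N'} v → SupportedBelow K v → K ≤ N → K ≤ N' → L N v ≈ L N' v
    L-agree v s K≤N K≤N' = trans (L-stable v s (ℕₚ.≤⇒≤′ K≤N)) (sym (L-stable v s (ℕₚ.≤⇒≤′ K≤N')))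

    fubini-as-L : ∀ k → fubini k x ≈ L (suc k) (power k)
    fubini-as-L k = sumTo-cong (suc k) (λ j → begin
      fromℕ (stirling2 k j ℕ.* (j !)) * pow x j            ≈⟨ *-cong (fromℕ-* (stirling2 k j) (j !)) refl ⟩
      fromℕ (stirling2 k j) * fromℕ (j !) * pow x j
        ≈⟨ solve 3 (λ a b c → a :* b :* c := b :* c :* a) refl (fromℕ (stirling2 k j)) (fromℕ (j !)) (pow x j) ⟩
      weight j * power k j                                  ∎)

    umbralFrom-as-L : ∀ p k N → length p ℕ.+ suc k ≤ N → umbralFrom k p x ≈ L N (mulPol p 0# (power k))
    umbralFrom-as-L []      k N le = sym (L-zero N)
    umbralFrom-as-L (b ∷ p) k N le = begin
      b * fubini k x + umbralFrom (suc k) p x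
        ≈⟨ +-cong (*-cong refl (trans (fubini-as-L k) head-stable))
                  (umbralFrom-as-L p (suc k) N (≡.subst (_≤ N) (≡.sym (ℕₚ.+-suc (length p) (suc k))) le)) ⟩
      b * L N (power k) + L N (mulPol p 0# (power (suc k)))
        ≈⟨ +-cong refl (L-cong N (λ j → trans (mulPol-cong p refl (power-suc k) j) (mulPol-mulU p 0# (power k) j))) ⟩
      b * L N (power k) + L N (mulU 0# (mulPol p 0# (power k))) ≈⟨ sym (L-linear N b (power k) _) ⟩
      L N (mulPol (b ∷ p) 0# (power k)) ∎
      where
      head-stable : L (suc k) (power k) ≈ L N (power k)
      head-stable = L-agree (power k) (power-supported k) ℕₚ.≤-refl
                      (ℕₚ.≤-trans (ℕₚ.m≤n+m (suc k) (length p)) (ℕₚ.≤-trans (ℕₚ.n≤1+n _) le))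

    -- Telescoping form of the functional equation  x·L(g(u+1)) + g(0) = (x+1)·L(g(u)),
    -- with the boundary term  N! x^N v_N.
    L-translate : ∀ N v → (x + 1#) * L N v + weight N * v N ≈ x * L N (translate v) + v 0
    L-translate zero v =
      solve 2 (λ X V → (X :+ con 1) :* con 0 :+ ((con 1 :+ con 0) :* con 1) :* V := X :* con 0 :+ V) refl x (v 0)
    L-translate (suc N) v = begin
      (x + 1#) * (L N v + weight N * v N) + weight (suc N) * v (suc N)
        ≈⟨ +-cong refl (*-cong (*-cong (fromℕ-* (suc N) (N !)) refl) refl) ⟩
      (x + 1#) * (L N v + C * Y * v N) + M * C * (x * Y) * v (suc N)
        ≈⟨ solve 7 (λ X P C Y V M W → (X :+ con 1) :* (P :+ C :* Y :* V) :+ M :* C :* (X :* Y) :* W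
                     := ((X :+ con 1) :* P :+ C :* Y :* V) :+ X :* (C :* Y :* (V :+ M :* W))) refl
             x (L N v) C Y (v N) M (v (suc N)) ⟩
      ((x + 1#) * L N v + weight N * v N) + x * (C * Y * translate v N) ≈⟨ +-cong (L-translate N v) refl ⟩
      (x * L N (translate v) + v 0) + x * (C * Y * translate v N)
        ≈⟨ solve 4 (λ X Q V₀ T → (X :* Q :+ V₀) :+ X :* T := X :* (Q :+ T) :+ V₀) refl
             x (L N (translate v)) (v 0) (C * Y * translate v N) ⟩
      x * L (suc N) (translate v) + v 0 ∎
      where
      C = fromℕ (N !)
      Y = pow x N
      M = fromℕ (suc N)

    module Shifts (f : Pol) where

      K : ℕ
      K = length f ℕ.+ 1

      shifted : ℕ → Seq
      shifted m = mulPol f (fromℕ m) one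

      shifted-supported : ∀ m → SupportedBelow K (shifted m)
      shifted-supported m = mulPol-supported f 1 _ one one-supported

      umbral-as-L : umbral f x ≈ L K (shifted 0)
      umbral-as-L = trans (umbralFrom-as-L f 0 K ℕₚ.≤-refl) (L-cong K (mulPol-cong f refl power-zero))

      umbral-shiftBy-as-L : ∀ m → umbral (shiftBy (fromℕ m) f) x ≈ L K (shifted m)
      umbral-shiftBy-as-L m = begin
        umbral s x                   ≈⟨ umbralFrom-as-L s 0 N (ℕₚ.m≤m+n _ K) ⟩
        L N (mulPol s 0# (power 0))
          ≈⟨ L-cong N (λ j → trans (mulPol-cong s refl power-zero j)
                      (trans (mulPol-shiftBy (fromℕ m) f 0# one j) (mulPol-cong f (+-identityˡ _) (λ _ → refl) j))) ⟩
        L N (shifted m)              ≈⟨ L-agree (shifted m) (shifted-supported m) (ℕₚ.m≤n+m K (length s ℕ.+ 1)) ℕₚ.≤-refl ⟩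
        L K (shifted m)              ∎
        where
        s = shiftBy (fromℕ m) f
        N = length s ℕ.+ 1 ℕ.+ K

      recurrence : ∀ m → x * L K (shifted (suc m)) + eval f (fromℕ m) ≈ (x + 1#) * L K (shifted m)
      recurrence m = begin
        x * L K (shifted (suc m)) + eval f (fromℕ m)
          ≈⟨ +-cong (*-cong refl (L-cong K (λ j → sym (trans (translate-mulPol f (fromℕ m) j)
                                                              (mulPol-cong f (+-comm _ _) (λ _ → refl) j)))))
                    (sym (mulPol-one-at-0 f (fromℕ m))) ⟩
        x * L K (translate (shifted m)) + shifted m 0   ≈⟨ sym (L-translate K (shifted m)) ⟩
        (x + 1#) * L K (shifted m) + weight K * shifted m K
          ≈⟨ +-cong refl (*-cong refl (shifted-supported m K ℕₚ.≤-refl)) ⟩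
        (x + 1#) * L K (shifted m) + weight K * 0#      ≈⟨ trans (+-cong refl (zeroʳ _)) (+-identityʳ _) ⟩
        (x + 1#) * L K (shifted m)                      ∎

theorem4 : ∀ {c ℓ} (R : CommutativeRing c ℓ) →
    let open CommutativeRing R
        open Poly R
    in (f : Pol) (m : ℕ) → 1 ≤ m → (x : Carrier) →
       pow (x + 1#) m * umbral f x - pow x m * umbral (shiftBy (fromℕ m) f) x
         ≈ sumTo m (λ k → eval f (fromℕ k) * pow (x + 1#) (m ∸ 1 ∸ k) * pow x k)
theorem4 R f m _ x = begin
    pow (x + 1#) m * umbral f x - pow x m * umbral (shiftBy (fromℕ m) f) x
      ≈⟨ //-cong₂ (*-cong refl umbral-as-L) (*-cong refl (umbral-shiftBy-as-L m)) ⟩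
    pow (x + 1#) m * b 0 - pow x m * b m
      ≈⟨ //-cong₂ (unroll (λ k → eval f (fromℕ k)) b (x + 1#) x recurrence m) refl ⟩
    (binomialSum (λ k → eval f (fromℕ k)) (x + 1#) x m + pow x m * b m) - pow x m * b m
      ≈⟨ //-rightDividesʳ _ _ ⟩
    sumTo m (λ k → eval f (fromℕ k) * pow (x + 1#) (m ∸ 1 ∸ k) * pow x k) ∎
  where
  open CommutativeRing R
  open Poly R
  open FallingFactorialCalculus R
  open Umbral x
  open Shifts f
  open GroupProperties +-group using (//-cong₂; //-rightDividesʳ)
  open import Relation.Binary.Reasoning.Setoid setoid

  b : ℕ → Carrier
  b n = L K (shifted n)
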